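{- The natural deduction system for $\mathcal{L}_{qu}$ is complete: for every set $\Gamma\cup\{\phi\}$ of $\mathcal{L}_{qu}$-formulas, if $\Gamma\models\phi$ then $\Gamma\vdash\phi$.
   Context: Fix a finite set $\mathbb{P}$ of propositional symbols; a valuation is $v:\mathbb{P}\to\{0,1\}$ with $v(\top)=1,v(\bot)=0$; a team is a set of valuations. $\mathcal{L}_{qu}$: $\phi::=\bot\mid\mathsf{x}\subseteq\mathsf{p}\mid\phi\land\phi\mid\phi\sqcup\phi$, with $\mathsf{x}$ a finite sequence of constants $\top,\bot$, $\mathsf{p}$ a sequence of symbols of $\mathbb{P}$ without repetitions, $|\mathsf{x}|=|\mathsf{p}|$ (the empty sequence $\langle\rangle$ allowed). Semantics: $T\models\bot$ iff $T=\emptyset$; $T\models\mathsf{x}\subseteq\mathsf{p}$ iff for every $v\in T$ there is $v'\in T$ with $v(\mathsf{x})=v'(\mathsf{p})$; $\land$ as usual; $T\models\phi\sqcup\psi$ iff $T\models\phi$ or $T\models\psi$. $\Gamma\models\phi$ iff every team satisfying all of $\Gamma$ satisfies $\phi$. $\Gamma\vdash\phi$ means a natural deduction derivation of $\phi$ with undischarged assumptions in $\Gamma$ using: ($\bot$E) from $\bot$ infer any $\phi$; ($\top$I) infer $\langle\rangle\subseteq\langle\rangle$; ($\land$I) from $\phi,\psi$ infer $\phi\land\psi$; ($\land$E) from $\phi\land\psi$ infer $\phi$, and $\psi$; ($\sqcup$I) from $\phi$ infer $\phi\sqcup\psi$ and $\psi\sqcup\phi$; ($\sqcup$E) from $\phi\sqcup\psi$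 and derivations of $\chi$ from $\phi$ and from $\psi$, infer $\chi$ discharging them; ($\subseteq$Proj) from $\mathsf{x}y\subseteq\mathsf{p}q$ infer $\mathsf{x}\subseteq\mathsf{p}$; ($\subseteq$Perm) from $\mathsf{x}\mathsf{y}\mathsf{z}\subseteq\mathsf{u}\mathsf{v}\mathsf{w}$ infer $\mathsf{x}\mathsf{z}\mathsf{y}\subseteq\mathsf{u}\mathsf{w}\mathsf{v}$ provided $|\mathsf{y}|=|\mathsf{v}|$, $|\mathsf{z}|=|\mathsf{w}|$; ($\subseteq$Ext) from $\mathsf{x}\subseteq\mathsf{p}$ and derivations of $\chi$ from $\mathsf{x}\top\subseteq\mathsf{p}q$ and from $\mathsf{x}\bot\subseteq\mathsf{p}q$ ($q$ a symbol not in $\mathsf{p}$), infer $\chi$ discharging them. -}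

module Defs where

open import Data.Nat using (ℕ)
open import Data.Empty using (⊥)
open import Data.Sum using (_⊎_)
open import Data.Fin using (Fin)
open import Data.Bool using (Bool; true; false)
open import Data.Product using (_×_; _,_; proj₁; proj₂; ∃)
open import Data.List using (List; []; _∷_; _++_; [_]; map)
open import Data.List.Relation.Unary.All using (All)
open import Data.List.Relation.Unary.Unique.Propositional using (Unique)
open import Data.List.Membership.Propositional using (_∈_)
open import Relation.Binary.PropositionalEquality using (_≡_)

-- Propositional symbols: ℙ = Fin n.  Constants ⊤,⊥ are encoded as true,false.
Valuation : ℕ → Set
Valuation n = Fin n → Bool

Team : ℕ → Set₁
Team n = Valuation n → Set

-- An inclusion atom x ⊆ p with |x| = |p| is encoded as the list of pairs
-- (x_i , p_i); the condition that p has no repetitions is carried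
-- (irrelevantly) in the constructor.
Pairs : ℕ → Set
Pairs n = List (Bool × Fin n)

syms : ∀ {n} → Pairs n → List (Fin n)
syms = map proj₂

infixr 6 _∧'_
infixr 5 _⊔'_

data Fm (n : ℕ) : Set where
  ⊥'   : Fm n
  inc  : (a : Pairs n) → .(Unique (syms a)) → Fm n
  _∧'_ : Fm n → Fm n → Fm n
  _⊔'_ : Fm n → Fm n → Fm n

-- v(x) = v'(p): the constant x_i equals v'(p_i) for every i
-- (v(⊤) = true, v(⊥) = false, independent of v).
Matches : ∀ {n} → Valuation n → Pairs n → Set
Matches v' a = All (λ xp → v' (proj₂ xp) ≡ proj₁ xp) a

_⊨_ : ∀ {n} → Team n → Fm n → Set
T ⊨ ⊥'      = ∀ v → T v → ⊥
T ⊨ inc a _ = ∀ v → T v → ∃ λ v' → T v' × Matches v' a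
T ⊨ (φ ∧' ψ) = (T ⊨ φ) × (T ⊨ ψ)
T ⊨ (φ ⊔' ψ) = (T ⊨ φ) ⊎ (T ⊨ ψ)

FmSet : ℕ → Set₁
FmSet n = Fm n → Set

_⊨ˢ_ : ∀ {n} → FmSet n → Fm n → Set₁
_⊨ˢ_ {n} Γ φ = (T : Team n) → (∀ ψ → Γ ψ → T ⊨ ψ) → T ⊨ φ

-- Natural deduction.  Der Γ Δ φ : a derivation of φ whose undischarged
-- assumptions lie in Γ or in the list Δ of (currently open, later to be
-- discharged) assumptions.
data Der {n : ℕ} (Γ : FmSet n) : List (Fm n) → Fm n → Set where
  hyp   : ∀ {Δ φ} → Γ φ → Der Γ Δ φ
  ass   : ∀ {Δ φ} → φ ∈ Δ → Der Γ Δ φ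
  ⊥E    : ∀ {Δ} φ → Der Γ Δ ⊥' → Der Γ Δ φ
  ⊤I    : ∀ {Δ} → Der Γ Δ (inc [] Unique.[])
  ∧I    : ∀ {Δ φ ψ} → Der Γ Δ φ → Der Γ Δ ψ → Der Γ Δ (φ ∧' ψ)
  ∧E₁   : ∀ {Δ φ ψ} → Der Γ Δ (φ ∧' ψ) → Der Γ Δ φ
  ∧E₂   : ∀ {Δ φ ψ} → Der Γ Δ (φ ∧' ψ) → Der Γ Δ ψ
  ⊔I₁   : ∀ {Δ φ} ψ → Der Γ Δ φ → Der Γ Δ (φ ⊔' ψ)
  ⊔I₂   : ∀ {Δ ψ} φ → Der Γ Δ ψ → Der Γ Δ (φ ⊔' ψ)
  ⊔E    : ∀ {Δ φ ψ χ} → Der Γ Δ (φ ⊔' ψ) → Der Γ (φ ∷ Δ) χ → Der Γ (ψ ∷ Δ) χ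
          → Der Γ Δ χ
  -- from x y ⊆ p q infer x ⊆ p
  ⊆Proj : ∀ {Δ} a y .{u} .(u' : Unique (syms a))
          → Der Γ Δ (inc (a ++ [ y ]) u) → Der Γ Δ (inc a u')
  -- from x y z ⊆ u v w infer x z y ⊆ u w v
  ⊆Perm : ∀ {Δ} a b c .{u} .(u' : Unique (syms (a ++ c ++ b)))
          → Der Γ Δ (inc (a ++ b ++ c) u) → Der Γ Δ (inc (a ++ c ++ b) u')
  -- from x ⊆ p and derivations of χ from x⊤ ⊆ pq and from x⊥ ⊆ pq infer χ;
  -- the hypotheses u⊤, u⊥ (no repetitions in pq) say exactly q ∉ p
  ⊆Ext  : ∀ {Δ χ} a q .{u}
          .(u⊤ : Unique (syms (a ++ [ (true , q) ])))
          .(u⊥ : Unique (syms (a ++ [ (false , q) ])))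
          → Der Γ Δ (inc a u)
          → Der Γ (inc (a ++ [ (true , q) ]) u⊤ ∷ Δ) χ
          → Der Γ (inc (a ++ [ (false , q) ]) u⊥ ∷ Δ) χ
          → Der Γ Δ χ

_⊢_ : ∀ {n} → FmSet n → Fm n → Set
Γ ⊢ φ = Der Γ [] φ

{-# OPTIONS --safe #-}
module Submission where

-- Over n symbols there are finitely many valuations, so a finite team is a subset m of a fixed
-- enumeration of them, and its characteristic formula Θ m is the conjunction of the total atoms
-- v(p₁)…v(pₙ) ⊆ p₁…pₙ for v ∈ m.  A nonempty team satisfies x ⊆ p exactly when one of its
-- members realises x on p.  Hence (i) every φ derives the disjunction of Θ m over a finite list
-- NF φ of nonempty finite teams satisfying φ (an atom is split by ⊆Ext into total atoms), and
-- (ii) Θ m derives every formula satisfied by the nonempty team m.  Since there are finitely many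
-- finite teams, excluded middle picks for each one a hypothesis of Γ failing on it (if any); the
-- conjunction ψ₀ of these is derivable from Γ, every team in NF ψ₀ satisfies all of Γ and hence φ,
-- so φ follows from the disjunction by (ii).

open import Level using (0ℓ)
open import Axiom.ExcludedMiddle using (ExcludedMiddle)
open import Function using (_∘_; id)
open import Data.Nat using (ℕ; zero; suc)
open import Data.Bool using (true; false)
import Data.Bool.Properties as Bool
open import Data.Empty using (⊥-elim)
open import Data.Sum using (inj₁; inj₂)
import Data.Sum as Sum
open import Data.Product using (_×_; _,_; proj₁; proj₂; ∃)
import Data.Product as Product
open import Data.Fin using (Fin; zero; suc) renaming (_≟_ to _≟ᶠ_)
open import Data.Fin.Subset using (Subset; inside; outside; ⁅_⁆; _∪_; Nonempty)
  renaming (_∈_ to _∈ₛ_; _⊆_ to _⊆ₛ_)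
open import Data.Fin.Subset.Properties using (x∈⁅x⁆; x∈⁅y⁆⇒x≡y; x∈p∪q⁻; p⊆p∪q; q⊆p∪q)
open import Data.Vec using ([]; _∷_; here; there)
open import Data.Vec.Functional using () renaming (_∷_ to cons)
open import Data.List
  using (List; []; _∷_; _++_; [_]; map; length; lookup; allFin; filter; cartesianProductWith)
open import Data.List.Properties using (++-assoc; ++-identityʳ; map-∘; map-id)
open import Data.List.Relation.Unary.All as All using (All; []; _∷_)
open import Data.List.Relation.Unary.All.Properties using (anti-mono; ¬Any⇒All¬)
open import Data.List.Relation.Unary.Any as Any using (Any; here; there)
import Data.List.Relation.Unary.Any.Properties as Any
open import Data.List.Relation.Unary.AllPairs as AllPairs using (allPairs?)
open import Data.List.Relation.Unary.Unique.Propositional using (Unique; []; _∷_)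
import Data.List.Relation.Unary.Unique.Propositional.Properties as Unique
open import Data.List.Membership.Propositional using (_∈_)
open import Data.List.Membership.Propositional.Properties
  using (∈-map⁺; ∈-map⁻; ∈-++⁺ˡ; ∈-++⁺ʳ; ∈-++⁻; ∈-∃++; ∈-allFin; ∈-filter⁺; ∈-filter⁻;
         ∈-cartesianProductWith⁺; ∈-cartesianProductWith⁻)
open import Data.List.Relation.Binary.Subset.Propositional using (_⊆_)
open import Data.List.Relation.Binary.Subset.Propositional.Properties using (∷⁺ʳ)
import Data.List.Relation.Binary.Subset.Propositional.Properties as ⊆
open import Data.List.Relation.Binary.Permutation.Propositional using (_↭_; ↭⇒↭ₛ)
import Data.List.Relation.Binary.Permutation.Propositional.Properties as ↭
import Data.List.Relation.Binary.Permutation.Setoid.Properties as ↭ₛ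
open import Relation.Binary.PropositionalEquality using (_≡_; refl; sym; trans; subst; _≗_; setoid)
open import Relation.Nullary using (¬_; Dec; yes; no; ¬?; recompute)
open import Relation.Nullary.Decidable using (decidable-stable)
open import Relation.Unary using (Satisfiable) renaming (_⊆_ to _⊆ᵤ_)
open import Defs

⊆-delete : ∀ {A : Set} {x : A} {b} s t → All (λ y → ¬ x ≡ y) b → b ⊆ s ++ x ∷ t → b ⊆ t ++ s
⊆-delete s t x∉b b⊆ y∈b with ∈-++⁻ s (b⊆ y∈b)
... | inj₁ y∈s = ∈-++⁺ʳ t y∈s
... | inj₂ (here refl) = ⊥-elim (All.lookup x∉b y∈b refl)
... | inj₂ (there y∈t) = ∈-++⁺ˡ y∈t

Distinct : ∀ {n} → Pairs n → Set
Distinct a = Unique (syms a)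

-- The distinctness proof carried by `inc` is irrelevant; being decidable, it can be recomputed.
distinct? : ∀ {n} (a : Pairs n) → Dec (Distinct a)
distinct? a = allPairs? (λ p q → ¬? (p ≟ᶠ q)) (syms a)

module _ {n : ℕ} where

  Distinct-resp-↭ : {a b : Pairs n} → a ↭ b → Distinct a → Distinct b
  Distinct-resp-↭ π = ↭ₛ.Unique-resp-↭ (setoid (Fin n)) (↭⇒↭ₛ (↭.map⁺ proj₂ π))

  Distinct-drop : ∀ (a : Pairs n) {x r} → Distinct (a ++ x ∷ r) → Distinct (a ++ r)
  Distinct-drop a {x} {r} = AllPairs.tail ∘ Distinct-resp-↭ (↭.shift x a r)

  Distinct-snoc : ∀ (a : Pairs n) {q} b → Distinct a → ¬ q ∈ syms a → Distinct (a ++ [ (b , q) ])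
  Distinct-snoc a {q} b u q∉a = Distinct-resp-↭ (↭.∷↭∷ʳ (b , q) a) (¬Any⇒All¬ (syms a) q∉a ∷ u)

  Distinct-functional : ∀ {a : Pairs n} {x y p} → Distinct a → (x , p) ∈ a → (y , p) ∈ a → x ≡ y
  Distinct-functional (_ ∷ _) (here refl) (here refl) = refl
  Distinct-functional (p∉ ∷ _) (here refl) (there y∈) = ⊥-elim (All.lookup p∉ (∈-map⁺ proj₂ y∈) refl)
  Distinct-functional (p∉ ∷ _) (there x∈) (here refl) = ⊥-elim (All.lookup p∉ (∈-map⁺ proj₂ x∈) refl)
  Distinct-functional (_ ∷ u) (there x∈) (there y∈) = Distinct-functional u x∈ y∈

  ⊤' : Fm n
  ⊤' = inc [] []

  graph : Valuation n → Pairs n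
  graph v = map (λ p → v p , p) (allFin n)

  Distinct-graph : ∀ v → Distinct (graph v)
  Distinct-graph v = subst Unique (trans (sym (map-id _)) (map-∘ (allFin n))) (Unique.allFin⁺ n)

  total-atom : Valuation n → Fm n
  total-atom v = inc (graph v) (Distinct-graph v)

  graph-⊇ : ∀ {v} {a : Pairs n} → Matches v a → a ⊆ graph v
  graph-⊇ {v} v⊨a {x , p} xp∈a =
    subst (λ x → (x , p) ∈ graph v) (All.lookup v⊨a xp∈a) (∈-map⁺ (λ p → v p , p) (∈-allFin p))

  graph-⊆ : ∀ {v} {a : Pairs n} → (∀ p → p ∈ syms a) → Matches v a → graph v ⊆ a
  graph-⊆ {v} {a} covers v⊨a x∈graph with ∈-map⁻ (λ p → v p , p) x∈graph
  ... | p , _ , refl with ∈-map⁻ proj₂ (covers p)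
  ... | (b , _) , bp∈a , refl = subst (λ b → (b , p) ∈ a) (sym (All.lookup v⊨a bp∈a)) bp∈a

  Matches-resp-≗ : ∀ {v w} {a : Pairs n} → w ≗ v → Matches v a → Matches w a
  Matches-resp-≗ w≗v = All.map λ {xp} → trans (w≗v (proj₂ xp))

  matches? : ∀ v (a : Pairs n) → Dec (Matches v a)
  matches? v = All.all? (λ xp → v (proj₂ xp) Bool.≟ proj₁ xp)

  valueOf : ∀ {a : Pairs n} {p} → p ∈ syms a → ∃ λ b → (b , p) ∈ a
  valueOf p∈a with ∈-map⁻ proj₂ p∈a
  ... | (b , _) , bp∈a , refl = b , bp∈a

  valuationOf : (a : Pairs n) → (∀ p → p ∈ syms a) → Valuation n
  valuationOf a covers p = proj₁ (valueOf (covers p))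

  valuationOf-matches : ∀ a (covers : ∀ p → p ∈ syms a) → Distinct a → Matches (valuationOf a covers) a
  valuationOf-matches a covers u =
    All.tabulate λ {(_ , p)} xp∈a → Distinct-functional u (proj₂ (valueOf (covers p))) xp∈a

valuations : ∀ k → List (Valuation k)
valuations zero = [ (λ ()) ]
valuations (suc k) = map (cons true) (valuations k) ++ map (cons false) (valuations k)

cons-∈-valuations : ∀ {k} b {P : Valuation (suc k) → Set}
                  → Any (P ∘ cons b) (valuations k) → Any P (valuations (suc k))
cons-∈-valuations true = Any.++⁺ˡ ∘ Any.map⁺
cons-∈-valuations {k} false = Any.++⁺ʳ (map (cons true) (valuations k)) ∘ Any.map⁺

cons-head-≗ : ∀ {k} {v : Valuation (suc k)} {w} → w ≗ v ∘ suc → cons (v zero) w ≗ v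
cons-head-≗ w≗ zero = refl
cons-head-≗ w≗ (suc p) = w≗ p

valuations-complete : ∀ {k} (v : Valuation k) → Any (_≗ v) (valuations k)
valuations-complete {zero} v = here (λ ())
valuations-complete {suc k} v =
  cons-∈-valuations (v zero) (Any.map cons-head-≗ (valuations-complete (v ∘ suc)))

FinTeam : ℕ → Set
FinTeam n = Subset (length (valuations n))

module _ {n : ℕ} where

  team : FinTeam n → Team n
  team m v = ∃ λ i → i ∈ₛ m × lookup (valuations n) i ≗ v

  Θ : (vs : List (Valuation n)) → Subset (length vs) → Fm n
  Θ [] [] = ⊤'
  Θ (v ∷ vs) (inside ∷ m) = total-atom v ∧' Θ vs m
  Θ (v ∷ vs) (outside ∷ m) = Θ vs m

  characteristic : FinTeam n → Fm n
  characteristic = Θ (valuations n)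

  ⋁ : {A : Set} → (A → Fm n) → List A → Fm n
  ⋁ f [] = ⊥'
  ⋁ f (x ∷ xs) = f x ⊔' ⋁ f xs

  ⋀-subsets : ∀ {k} → (Subset k → Fm n) → Fm n
  ⋀-subsets {zero} f = f []
  ⋀-subsets {suc k} f = ⋀-subsets (f ∘ (inside ∷_)) ∧' ⋀-subsets (f ∘ (outside ∷_))

  realises? : ∀ a (i : Fin (length (valuations n))) → Dec (Matches (lookup (valuations n) i) a)
  realises? a i = matches? (lookup (valuations n) i) a

  atom-NF : Pairs n → List (FinTeam n)
  atom-NF a = map ⁅_⁆ (filter (realises? a) (allFin _))

  NF : Fm n → List (FinTeam n)
  NF ⊥' = []
  NF (inc a _) = atom-NF a
  NF (φ ∧' ψ) = cartesianProductWith _∪_ (NF φ) (NF ψ)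
  NF (φ ⊔' ψ) = NF φ ++ NF ψ

  ⊨-upward : ∀ (φ : Fm n) {T T′ : Team n} → T ⊆ᵤ T′ → Satisfiable T → T ⊨ φ → T′ ⊨ φ
  ⊨-upward ⊥' _ (v , v∈T) T⊨⊥ = ⊥-elim (T⊨⊥ v v∈T)
  ⊨-upward (inc a _) T⊆T′ (v , v∈T) T⊨a _ _ with T⊨a v v∈T
  ... | w , w∈T , w⊨a = w , T⊆T′ w∈T , w⊨a
  ⊨-upward (φ ∧' ψ) T⊆T′ ne = Product.map (⊨-upward φ T⊆T′ ne) (⊨-upward ψ T⊆T′ ne)
  ⊨-upward (φ ⊔' ψ) T⊆T′ ne = Sum.map (⊨-upward φ T⊆T′ ne) (⊨-upward ψ T⊆T′ ne)

  team-mono : {m m′ : FinTeam n} → m ⊆ₛ m′ → team m ⊆ᵤ team m′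
  team-mono m⊆m′ (i , i∈m , eq) = i , m⊆m′ i∈m , eq

  team-satisfiable : {m : FinTeam n} → Nonempty m → Satisfiable (team m)
  team-satisfiable (i , i∈m) = lookup (valuations n) i , i , i∈m , λ _ → refl

  team-⁅⁆-⊨ : ∀ {i} {a : Pairs n} .{u} → Matches (lookup (valuations n) i) a → team ⁅ i ⁆ ⊨ inc a u
  team-⁅⁆-⊨ {i} i⊨a _ _ = lookup (valuations n) i , (i , x∈⁅x⁆ i , λ _ → refl) , i⊨a

  ⊨-⋀-subsets : ∀ {k} {f : Subset k → Fm n} {T} → T ⊨ ⋀-subsets f → ∀ m → T ⊨ f m
  ⊨-⋀-subsets {zero} T⊨ [] = T⊨
  ⊨-⋀-subsets {suc k} (T⊨ , _) (inside ∷ m) = ⊨-⋀-subsets T⊨ m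
  ⊨-⋀-subsets {suc k} (_ , T⊨) (outside ∷ m) = ⊨-⋀-subsets T⊨ m

  NF-sound : ∀ (φ : Fm n) {m} → m ∈ NF φ → Nonempty m × team m ⊨ φ
  NF-sound ⊥' ()
  NF-sound (inc a u) m∈ with ∈-map⁻ ⁅_⁆ m∈
  ... | i , i∈ , refl =
    (i , x∈⁅x⁆ i) , team-⁅⁆-⊨ {u = u} (proj₂ (∈-filter⁻ (realises? a) {xs = allFin _} i∈))
  NF-sound (φ ∧' ψ) m∈ with ∈-cartesianProductWith⁻ _∪_ (NF φ) (NF ψ) m∈
  ... | m₁ , m₂ , m₁∈ , m₂∈ , refl with NF-sound φ m₁∈ | NF-sound ψ m₂∈
  ... | (i , i∈m₁) , m₁⊨φ | m₂≠∅ , m₂⊨ψ =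
        (i , p⊆p∪q m₂ i∈m₁)
      , ⊨-upward φ (team-mono (p⊆p∪q m₂)) (team-satisfiable (i , i∈m₁)) m₁⊨φ
      , ⊨-upward ψ (team-mono (q⊆p∪q m₁ m₂)) (team-satisfiable m₂≠∅) m₂⊨ψ
  NF-sound (φ ⊔' ψ) m∈ with ∈-++⁻ (NF φ) m∈
  ... | inj₁ m∈φ = Product.map₂ inj₁ (NF-sound φ m∈φ)
  ... | inj₂ m∈ψ = Product.map₂ inj₂ (NF-sound ψ m∈ψ)

module _ {n : ℕ} {Γ : FmSet n} where

  weaken-assumptions : ∀ {Δ Δ′ φ} → Δ ⊆ Δ′ → Der Γ Δ φ → Der Γ Δ′ φ
  weaken-assumptions Δ⊆ (hyp φ∈Γ) = hyp φ∈Γ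
  weaken-assumptions Δ⊆ (ass φ∈Δ) = ass (Δ⊆ φ∈Δ)
  weaken-assumptions Δ⊆ (⊥E φ d) = ⊥E φ (weaken-assumptions Δ⊆ d)
  weaken-assumptions Δ⊆ ⊤I = ⊤I
  weaken-assumptions Δ⊆ (∧I d e) = ∧I (weaken-assumptions Δ⊆ d) (weaken-assumptions Δ⊆ e)
  weaken-assumptions Δ⊆ (∧E₁ d) = ∧E₁ (weaken-assumptions Δ⊆ d)
  weaken-assumptions Δ⊆ (∧E₂ d) = ∧E₂ (weaken-assumptions Δ⊆ d)
  weaken-assumptions Δ⊆ (⊔I₁ ψ d) = ⊔I₁ ψ (weaken-assumptions Δ⊆ d)
  weaken-assumptions Δ⊆ (⊔I₂ φ d) = ⊔I₂ φ (weaken-assumptions Δ⊆ d)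
  weaken-assumptions Δ⊆ (⊔E d e f) =
    ⊔E (weaken-assumptions Δ⊆ d) (weaken-assumptions (∷⁺ʳ _ Δ⊆) e) (weaken-assumptions (∷⁺ʳ _ Δ⊆) f)
  weaken-assumptions Δ⊆ (⊆Proj a y {u} u′ d) = ⊆Proj a y {u} u′ (weaken-assumptions Δ⊆ d)
  weaken-assumptions Δ⊆ (⊆Perm a b c {u} u′ d) = ⊆Perm a b c {u} u′ (weaken-assumptions Δ⊆ d)
  weaken-assumptions Δ⊆ (⊆Ext a q {u} u⊤ u⊥ d e f) =
    ⊆Ext a q {u} u⊤ u⊥ (weaken-assumptions Δ⊆ d)
      (weaken-assumptions (∷⁺ʳ _ Δ⊆) e) (weaken-assumptions (∷⁺ʳ _ Δ⊆) f)

  weaken-assumption : ∀ {Δ ψ φ} → Der Γ Δ φ → Der Γ (ψ ∷ Δ) φ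
  weaken-assumption = weaken-assumptions there

  ⋁-intro : ∀ {A : Set} {f : A → Fm n} {xs x Δ} → x ∈ xs → Der Γ Δ (f x) → Der Γ Δ (⋁ f xs)
  ⋁-intro {f = f} {y ∷ ys} (here refl) d = ⊔I₁ (⋁ f ys) d
  ⋁-intro {f = f} {y ∷ ys} (there x∈) d = ⊔I₂ (f y) (⋁-intro x∈ d)

  ⋁-elim : ∀ {A : Set} {f : A → Fm n} xs {Δ χ}
         → (∀ {x} → x ∈ xs → Der Γ (f x ∷ Δ) χ) → Der Γ Δ (⋁ f xs) → Der Γ Δ χ
  ⋁-elim [] _ d = ⊥E _ d
  ⋁-elim (x ∷ xs) h d =
    ⊔E d (h (here refl)) (⋁-elim xs (weaken-assumptions (∷⁺ʳ _ there) ∘ h ∘ there) (ass (here refl)))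

  ⋁-mono : ∀ {A : Set} {f : A → Fm n} {xs ys Δ} → xs ⊆ ys → Der Γ Δ (⋁ f xs) → Der Γ Δ (⋁ f ys)
  ⋁-mono {xs = xs} xs⊆ys = ⋁-elim xs (λ x∈ → ⋁-intro (xs⊆ys x∈) (ass (here refl)))

  ⋁-cartesianProductWith : ∀ {A : Set} {f : A → Fm n} {_∙_ : A → A → A}
    → (∀ {Δ x y} → Der Γ Δ (f x) → Der Γ Δ (f y) → Der Γ Δ (f (x ∙ y)))
    → ∀ xs ys {Δ} → Der Γ Δ (⋁ f xs) → Der Γ Δ (⋁ f ys)
    → Der Γ Δ (⋁ f (cartesianProductWith _∙_ xs ys))
  ⋁-cartesianProductWith {_∙_ = _∙_} combine xs ys d₁ d₂ =
    ⋁-elim xs (λ x∈ → ⋁-elim ys (λ y∈ →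
        ⋁-intro (∈-cartesianProductWith⁺ _∙_ x∈ y∈) (combine (ass (there (here refl))) (ass (here refl))))
      (weaken-assumption d₂)) d₁

  inc-cast : ∀ {Δ a b} .{u : Distinct a} (a≡b : a ≡ b)
           → Der Γ Δ (inc a u) → Der Γ Δ (inc b (subst Distinct a≡b u))
  inc-cast refl d = d

  ⊆Drop : ∀ a r {Δ} .{u : Distinct (a ++ r)} .{u′ : Distinct a}
        → Der Γ Δ (inc (a ++ r) u) → Der Γ Δ (inc a u′)
  ⊆Drop a [] d = inc-cast (++-identityʳ a) d
  ⊆Drop a (x ∷ r) {u = u} d =
    ⊆Drop a r
      (⊆Proj (a ++ r) x (Distinct-drop a u)
        (inc-cast (sym (++-assoc a r [ x ]))
          (⊆Perm a [ x ] r (Distinct-resp-↭ (↭.++⁺ˡ a (↭.∷↭∷ʳ x r)) u) d)))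

  ⊆Select : ∀ p {r} b {Δ} .{u : Distinct (p ++ r)} .{u′ : Distinct (p ++ b)} → Unique b → b ⊆ r
          → Der Γ Δ (inc (p ++ r) u) → Der Γ Δ (inc (p ++ b) u′)
  ⊆Select p {r} [] {u′ = u′} _ _ d =
    inc-cast (sym (++-identityʳ p)) (⊆Drop p r {u′ = subst Distinct (++-identityʳ p) u′} d)
  ⊆Select p (x ∷ b) {u = u} {u′} (x∉b ∷ b-unique) x∷b⊆r d with ∈-∃++ (x∷b⊆r (here refl))
  ... | s , t , refl =
    inc-cast (++-assoc p [ x ] b)
      (⊆Select (p ++ [ x ]) b {u′ = subst Distinct (sym (++-assoc p [ x ] b)) u′}
         b-unique (⊆-delete s t x∉b (x∷b⊆r ∘ there))
         (inc-cast (sym (++-assoc p [ x ] (t ++ s)))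
           (⊆Perm p s (x ∷ t) (Distinct-resp-↭ (↭.++⁺ˡ p (↭.++-comm s (x ∷ t))) u) d)))

  ⊆Sub : ∀ {a} b {Δ} .{u : Distinct a} .(u′ : Distinct b) → b ⊆ a
       → Der Γ Δ (inc a u) → Der Γ Δ (inc b u′)
  ⊆Sub b u′ b⊆a = ⊆Select [] b (Unique.map⁻ (recompute (distinct? b) u′)) b⊆a

  -- ⊆Ext concludes an arbitrary χ, so extending an atom is phrased in continuation-passing style.
  ⊆Extend : ∀ (qs : List (Fin n)) a {Δ χ} .{u : Distinct a}
          → (∀ {Δ′} a′ .{u′ : Distinct a′} → All (_∈ syms a′) qs → a ⊆ a′
             → Der Γ Δ′ (inc a′ u′) → Der Γ Δ′ χ)
          → Der Γ Δ (inc a u) → Der Γ Δ χ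
  ⊆Extend [] a k d = k a [] id d
  ⊆Extend (q ∷ qs) a {Δ} {χ} {u} k d with Any.any? (q ≟ᶠ_) (syms a)
  ... | yes q∈a = ⊆Extend qs a (λ a′ qs∈a′ a⊆a′ → k a′ (⊆.map⁺ proj₂ a⊆a′ q∈a ∷ qs∈a′) a⊆a′) d
  ... | no q∉a =
    ⊆Ext a q (Distinct-snoc a true u q∉a) (Distinct-snoc a false u q∉a) d (extend true) (extend false)
    where
    extend : ∀ b → Der Γ (inc (a ++ [ (b , q) ]) (Distinct-snoc a b u q∉a) ∷ Δ) χ
    extend b = ⊆Extend qs (a ++ [ (b , q) ])
      (λ a′ qs∈a′ a+⊆a′ →
         k a′ (⊆.map⁺ proj₂ a+⊆a′ (∈-map⁺ proj₂ (∈-++⁺ʳ a (here refl))) ∷ qs∈a′) (a+⊆a′ ∘ ∈-++⁺ˡ))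
      (ass (here refl))

  Θ-intro : ∀ vs {m Δ} → (∀ {i} → i ∈ₛ m → Der Γ Δ (total-atom (lookup vs i))) → Der Γ Δ (Θ vs m)
  Θ-intro [] {[]} _ = ⊤I
  Θ-intro (v ∷ vs) {inside ∷ m} h = ∧I (h here) (Θ-intro vs (h ∘ there))
  Θ-intro (v ∷ vs) {outside ∷ m} h = Θ-intro vs (h ∘ there)

  Θ-elim : ∀ vs {m i Δ} → i ∈ₛ m → Der Γ Δ (Θ vs m) → Der Γ Δ (total-atom (lookup vs i))
  Θ-elim (v ∷ vs) {inside ∷ m} here d = ∧E₁ d
  Θ-elim (v ∷ vs) {inside ∷ m} (there i∈m) d = Θ-elim vs i∈m (∧E₂ d)
  Θ-elim (v ∷ vs) {outside ∷ m} (there i∈m) d = Θ-elim vs i∈m d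

  Θ-⁅⁆ : ∀ vs {i Δ} → Der Γ Δ (total-atom (lookup vs i)) → Der Γ Δ (Θ vs ⁅ i ⁆)
  Θ-⁅⁆ vs {i} {Δ} d =
    Θ-intro vs λ j∈⁅i⁆ → subst (λ j → Der Γ Δ (total-atom (lookup vs j))) (sym (x∈⁅y⁆⇒x≡y i j∈⁅i⁆)) d

  Θ-∪ : ∀ vs {m₁ m₂ Δ} → Der Γ Δ (Θ vs m₁) → Der Γ Δ (Θ vs m₂) → Der Γ Δ (Θ vs (m₁ ∪ m₂))
  Θ-∪ vs {m₁} {m₂} d₁ d₂ = Θ-intro vs λ i∈ →
    Sum.[ (λ i∈m₁ → Θ-elim vs i∈m₁ d₁) , (λ i∈m₂ → Θ-elim vs i∈m₂ d₂) ] (x∈p∪q⁻ m₁ m₂ i∈)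

  ⊢total-atom-NF : ∀ {a a′ Δ} .{u′ : Distinct a′} → (∀ p → p ∈ syms a′) → a ⊆ a′
                 → Der Γ Δ (inc a′ u′) → Der Γ Δ (⋁ characteristic (atom-NF a))
  ⊢total-atom-NF {a} {a′} {u′ = u′} covers a⊆a′ d =
    ⋁-intro (∈-map⁺ ⁅_⁆ (∈-filter⁺ (realises? a) (∈-allFin i) (anti-mono a⊆a′ i⊨a′)))
      (Θ-⁅⁆ (valuations n) (⊆Sub _ (Distinct-graph _) (graph-⊆ covers i⊨a′) d))
    where
    v∈ : Any (_≗ valuationOf a′ covers) (valuations n)
    v∈ = valuations-complete (valuationOf a′ covers)
    i : Fin (length (valuations n))
    i = Any.index v∈
    i⊨a′ : Matches (lookup (valuations n) i) a′
    i⊨a′ = Matches-resp-≗ (Any.lookup-index v∈)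
             (valuationOf-matches a′ covers (recompute (distinct? a′) u′))

  ⊢NF : ∀ φ {Δ} → Der Γ Δ φ → Der Γ Δ (⋁ characteristic (NF φ))
  ⊢NF ⊥' d = d
  ⊢NF (inc a _) d =
    ⊆Extend (allFin n) a (λ _ covers → ⊢total-atom-NF (λ p → All.lookup covers (∈-allFin p))) d
  ⊢NF (φ ∧' ψ) d =
    ⋁-cartesianProductWith (Θ-∪ (valuations n)) (NF φ) (NF ψ) (⊢NF φ (∧E₁ d)) (⊢NF ψ (∧E₂ d))
  ⊢NF (φ ⊔' ψ) d =
    ⊔E d (⋁-mono ∈-++⁺ˡ (⊢NF φ (ass (here refl)))) (⋁-mono (∈-++⁺ʳ (NF φ)) (⊢NF ψ (ass (here refl))))

  characteristic-complete : ∀ φ {m Δ} → Nonempty m → team m ⊨ φ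
                          → Der Γ Δ (characteristic m) → Der Γ Δ φ
  characteristic-complete ⊥' m≠∅ m⊨⊥ _ = ⊥-elim (m⊨⊥ _ (proj₂ (team-satisfiable m≠∅)))
  characteristic-complete (inc b u) m≠∅ m⊨b d with m⊨b _ (proj₂ (team-satisfiable m≠∅))
  ... | _ , (j , j∈m , j≗v) , v⊨b =
    ⊆Sub b u (graph-⊇ (Matches-resp-≗ j≗v v⊨b)) (Θ-elim (valuations n) j∈m d)
  characteristic-complete (φ ∧' ψ) m≠∅ (m⊨φ , m⊨ψ) d =
    ∧I (characteristic-complete φ m≠∅ m⊨φ d) (characteristic-complete ψ m≠∅ m⊨ψ d)
  characteristic-complete (φ ⊔' ψ) m≠∅ (inj₁ m⊨φ) d = ⊔I₁ ψ (characteristic-complete φ m≠∅ m⊨φ d)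
  characteristic-complete (φ ⊔' ψ) m≠∅ (inj₂ m⊨ψ) d = ⊔I₂ φ (characteristic-complete ψ m≠∅ m⊨ψ d)

  ⋀-subsets-intro : ∀ {k} {f : Subset k → Fm n} {Δ} → (∀ m → Der Γ Δ (f m)) → Der Γ Δ (⋀-subsets f)
  ⋀-subsets-intro {zero} h = h []
  ⋀-subsets-intro {suc k} h = ∧I (⋀-subsets-intro (h ∘ (inside ∷_))) (⋀-subsets-intro (h ∘ (outside ∷_)))

module _ (lem : ExcludedMiddle 0ℓ) {n : ℕ} (Γ : FmSet n) where

  Violated : FinTeam n → Set
  Violated m = ∃ λ ψ → Γ ψ × ¬ (team m ⊨ ψ)

  violation : FinTeam n → Fm n
  violation m with lem {Violated m}
  ... | yes (ψ , _) = ψ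
  ... | no _ = ⊤'

  ⊢violation : ∀ m → Γ ⊢ violation m
  ⊢violation m with lem {Violated m}
  ... | yes (_ , ψ∈Γ , _) = hyp ψ∈Γ
  ... | no _ = ⊤I

  ⊨violation⇒⊨Γ : ∀ m → team m ⊨ violation m → ∀ ψ → Γ ψ → team m ⊨ ψ
  ⊨violation⇒⊨Γ m m⊨ ψ ψ∈Γ with lem {Violated m}
  ... | yes (_ , _ , m⊭) = ⊥-elim (m⊭ m⊨)
  ... | no ¬violated = decidable-stable lem (λ m⊭ψ → ¬violated (ψ , ψ∈Γ , m⊭ψ))

mainTheorem7 : ExcludedMiddle 0ℓ → (n : ℕ) (Γ : FmSet n) (φ : Fm n)
    → Γ ⊨ˢ φ → Γ ⊢ φ
mainTheorem7 lem n Γ φ Γ⊨φ = ⋁-elim (NF ψ₀) derive-φ (⊢NF ψ₀ (⋀-subsets-intro (⊢violation lem Γ)))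
  where
  ψ₀ : Fm n
  ψ₀ = ⋀-subsets (violation lem Γ)

  derive-φ : ∀ {m} → m ∈ NF ψ₀ → Der Γ (characteristic m ∷ []) φ
  derive-φ {m} m∈ with NF-sound ψ₀ m∈
  ... | m≠∅ , m⊨ψ₀ =
    characteristic-complete φ m≠∅ (Γ⊨φ (team m) (⊨violation⇒⊨Γ lem Γ m (⊨-⋀-subsets m⊨ψ₀ m)))
      (ass (here refl))
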